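{- Let $G$ be a graph and $M$ a matching in $G$ such that $(G,M)$ satisfies property $\mathcal{P}$. Let $e$ be an edge of $G_M$ coloured blue, and let $H$ be a 2-connected subgraph of $G_M$ with $e\in E(H)$. Then $H-e$ is not 2-connected.
   Context: All graphs are finite, simple and undirected. A graph is 2-connected if it has at least two vertices, is connected, and has no cut vertex. For a matching $M$ in $G$, $G[M]$ is the subgraph of $G$ induced by the endpoints of edges of $M$, and $G_M$ is the simple graph obtained from $G[M]$ by contracting each edge $xy\in M$ to a vertex $v_{xy}$ and removing parallel edges. Each edge $v_{ab}v_{cd}$ of $G_M$ is red if there exist labellings with $\{\{p,q\},\{r,s\}\}=\{\{a,b\},\{c,d\}\}$ such that $pr\in E(G)$, $d_{G[M]}(p)=2$ and $d_{G[M]}(q)>2$; otherwise it is blue. $(G,M)$ satisfies property $\mathcal{P}$ if (i) $G_M$ is 2-connected, and (ii) for every edge $ab\in E(G)\setminus M$ with $a,b\in V(G[M])$, there is no cycle in $G-ab$ containing both $a$ and $b$. -}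

module Defs where

open import Data.Nat using (ℕ; _<_)
open import Data.Fin using (Fin) renaming (_<_ to _<ᶠ_)
open import Data.Bool using (Bool; true; false; _∧_)
open import Data.List using (List; []; _∷_; length; filterᵇ; allFin; _∷ʳ_)
open import Data.Bool.ListAction using (any)
open import Data.List.Relation.Unary.Linked using (Linked)
open import Data.List.Relation.Unary.Unique.Propositional using (Unique)
open import Data.List.Membership.Propositional using (_∈_)
open import Data.Product using (Σ; ∃; ∃-syntax; _×_; _,_; proj₁; proj₂)
open import Data.Sum using (_⊎_)
open import Relation.Nullary using (¬_)
open import Relation.Binary.PropositionalEquality using (_≡_; _≢_)

data Walk {V : Set} (In : V → Set) (E : V → V → Set) : V → V → Set where
  here : ∀ {x} → In x → Walk In E x x
  step : ∀ {x y z} → In x → E x y → Walk In E y z → Walk In E x z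

Connected : {V : Set} → (V → Set) → (V → V → Set) → Set
Connected {V} In E = ∀ (x y : V) → In x → In y → Walk In E x y

_-ᵛ_ : {V : Set} → (V → Set) → V → (V → Set)
(In -ᵛ v) x = In x × x ≢ v

TwoConnected : {V : Set} → (V → Set) → (V → V → Set) → Set
TwoConnected {V} In E =
  (Σ V λ x → Σ V λ y → In x × In y × x ≢ y)
  × Connected In E
  × (∀ (v : V) → In v → Connected (In -ᵛ v) E)

SamePair : {V : Set} → V → V → V → V → Set
SamePair x y u w = (x ≡ u × y ≡ w) ⊎ (x ≡ w × y ≡ u)

_-ᵉ_ : {V : Set} → (V → V → Set) → V × V → (V → V → Set)
(E -ᵉ (u , w)) x y = E x y × ¬ SamePair x y u w

record Graph : Set where
  field
    n      : ℕ
    Adj    : Fin n → Fin n → Bool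
    sym    : ∀ x y → Adj x y ≡ Adj y x
    irrefl : ∀ x → Adj x x ≡ false

record Matching (G : Graph) : Set where
  open Graph G
  field
    M       : Fin n → Fin n → Bool
    M-sym   : ∀ x y → M x y ≡ M y x
    M⊆E     : ∀ x y → M x y ≡ true → Adj x y ≡ true
    M-match : ∀ x y z → M x y ≡ true → M x z ≡ true → y ≡ z

module _ (G : Graph) (Mt : Matching G) where
  open Graph G
  open Matching Mt

  -- x ∈ V(G[M]) : x is an endpoint of an edge of M
  covered : Fin n → Bool
  covered x = any (M x) (allFin n)

  degM : Fin n → ℕ
  degM p = length (filterᵇ (λ y → Adj p y ∧ covered y) (allFin n))

  -- vertices of G_M: v_{ab} represented by the unique ordered pair (a,b)
  -- with ab ∈ M and a < b
  VM : Fin n × Fin n → Set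
  VM (a , b) = M a b ≡ true × a <ᶠ b

  InPair : Fin n → Fin n × Fin n → Set
  InPair p (a , b) = p ≡ a ⊎ p ≡ b

  -- edges of G_M (contraction, loops and parallel edges removed)
  EM : Fin n × Fin n → Fin n × Fin n → Set
  EM u w = VM u × VM w × u ≢ w
         × (∃[ p ] ∃[ r ] (InPair p u × InPair r w × Adj p r ≡ true))

  Ord : Fin n → Fin n → Fin n × Fin n → Set
  Ord p q (a , b) = SamePair p q a b

  Red : Fin n × Fin n → Fin n × Fin n → Set
  Red u w = ∃[ p ] ∃[ q ] ∃[ r ] ∃[ s ]
      (((Ord p q u × Ord r s w) ⊎ (Ord p q w × Ord r s u))
       × Adj p r ≡ true × degM p ≡ 2 × 2 < degM q)

  Blue : Fin n × Fin n → Fin n × Fin n → Set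
  Blue u w = EM u w × ¬ Red u w

  AdjMinus : Fin n → Fin n → Fin n → Fin n → Set
  AdjMinus a b x y = Adj x y ≡ true × ¬ SamePair x y a b

  CycleThrough : Fin n → Fin n → Set
  CycleThrough a b = Σ (Fin n) λ x → Σ (List (Fin n)) λ xs →
      2 Data.Nat.≤ length xs × Unique (x ∷ xs)
      × Linked (AdjMinus a b) ((x ∷ xs) ∷ʳ x)
      × a ∈ (x ∷ xs) × b ∈ (x ∷ xs)

  PropertyP : Set
  PropertyP =
      TwoConnected VM EM
    × (∀ a b → Adj a b ≡ true → M a b ≡ false
         → covered a ≡ true → covered b ≡ true → ¬ CycleThrough a b)

  IsSubgraphM : (Fin n × Fin n → Set) → (Fin n × Fin n → Fin n × Fin n → Set) → Set
  IsSubgraphM HV HE =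
      (∀ v → HV v → VM v)
    × (∀ u w → HE u w → EM u w × HV u × HV w)
    × (∀ u w → HE u w → HE w u)

-- Write e = uw. As e is an edge of G_M, some p ∈ u and r ∈ w are adjacent in G, and pr ∉ M;
-- let pq and rs be the matching edges at p and r. If H − e were 2-connected we would find a
-- cycle of G − pr through p and r, contradicting (ii). By Whitney's ear argument it suffices
-- that no vertex x ∉ {p, r} separates p from r in G − pr. Walks of G_M lift to walks of G − pr
-- that stay inside the contracted pairs they visit, so a vertex x outside u ∪ w is avoided by
-- lifting a u–w walk of H − e that misses the pair of x (any u–w walk of H − e if that pair is
-- not in H). The partner q is avoided by leaving p through a third neighbour in G[M] and using
-- that G_M − u is connected. If p has no such neighbour then d(p) = 2, while the two neighbours
-- of u in H − e other than w give q two more neighbours, so d(q) > 2 and e would be red. The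
-- partner s is handled symmetrically.

module Submission where

open import Defs
open import Data.Bool using (Bool; true; false; T; _∧_)
open import Data.Bool.Properties using (T-≡; T-∧)
open import Data.Empty using (⊥-elim)
open import Data.Fin using (Fin)
open import Data.Fin.Properties using (<-cmp; <-asym; any?) renaming (_≟_ to _≟ᶠ_)
open import Data.List using (List; []; _∷_; _++_; _∷ʳ_; _ʳ++_; [_]; length; allFin)
open import Data.List.Properties using (++-assoc; length-++)
open import Data.List.Membership.Propositional using (_∈_; _∉_; lose)
open import Data.List.Membership.Propositional.Properties
  using (∈-++⁺ˡ; ∈-++⁺ʳ; ∈-++⁻; ∈-∃++; ∈-allFin; ∈-filter⁺; ∈-filter⁻)
open import Data.List.Relation.Binary.Disjoint.Propositional using (Disjoint)
open import Data.List.Relation.Binary.Subset.Propositional using (_⊆_)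
open import Data.List.Relation.Unary.All using ([]; _∷_)
import Data.List.Relation.Unary.All as All
open import Data.List.Relation.Unary.All.Properties using (¬Any⇒All¬; anti-mono)
open import Data.List.Relation.Unary.Any using (here; there; satisfied)
open import Data.List.Relation.Unary.Any.Properties
  using (any⁺; any⁻) renaming (reverse⁻ to Any-reverse⁻)
open import Data.List.Relation.Unary.Linked using (Linked; [-]; _∷_)
open import Data.List.Relation.Unary.Unique.Propositional using (Unique; []; _∷_; tail)
open import Data.List.Relation.Unary.Unique.Propositional.Properties
  using (Unique[x∷xs]⇒x∉xs; allFin⁺; filter⁺) renaming (++⁺ to Unique-++⁺)
open import Data.Nat using (suc; _+_; _≤_; _<_; z≤n; s≤s)
open import Data.Nat.Properties using (+-suc; +-mono-≤; ≤-antisym; module ≤-Reasoning)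
open import Data.Product using (Σ; _×_; _,_; proj₁; proj₂)
open import Data.Sum using (_⊎_; inj₁; inj₂; [_,_]′) renaming (swap to ⊎-swap)
open import Function using (_∘_; id; Equivalence)
open import Level using (0ℓ)
open import Relation.Binary using (Rel; Symmetric; DecidableEquality)
open import Relation.Binary.Construct.Closure.ReflexiveTransitive
  using (Star; ε; _◅_; _◅◅_; revApp; reverse; map)
open import Relation.Binary.Definitions using (tri<; tri≈; tri>)
open import Relation.Binary.PropositionalEquality
  using (_≡_; _≢_; refl; sym; trans; cong; subst; module ≡-Reasoning)
open import Relation.Nullary using (¬_; yes; no; ¬?)
open import Relation.Nullary.Decidable using (T?; _×-dec_; _⊎-dec_; ¬¬-excluded-middle)
open import Relation.Unary using (Pred; Decidable)

Unique-∷ʳ⁻ : {A : Set} {x : A} (xs : List A) → Unique (xs ∷ʳ x) → Unique xs × x ∉ xs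
Unique-∷ʳ⁻ [] _ = [] , λ ()
Unique-∷ʳ⁻ {x = x} (y ∷ xs) (y∉ ∷ u) with Unique-∷ʳ⁻ xs u
... | uxs , x∉xs = anti-mono ∈-++⁺ˡ y∉ ∷ uxs , x∉y∷xs
  where
  x∉y∷xs : x ∉ y ∷ xs
  x∉y∷xs (here refl) = All.lookup y∉ (∈-++⁺ʳ xs (here refl)) refl
  x∉y∷xs (there x∈xs) = x∉xs x∈xs

Unique-∷⁺ : {A : Set} {x : A} {xs : List A} → x ∉ xs → Unique xs → Unique (x ∷ xs)
Unique-∷⁺ x∉xs u = ¬Any⇒All¬ _ x∉xs ∷ u

Unique-⊆⇒length≤ : {A : Set} {xs ys : List A} → Unique xs → xs ⊆ ys → length xs ≤ length ys
Unique-⊆⇒length≤ {xs = []} _ _ = z≤n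
Unique-⊆⇒length≤ {xs = x ∷ xs} ux@(_ ∷ u) xs⊆ys with ∈-∃++ (xs⊆ys (here refl))
... | ys₁ , ys₂ , refl = begin
  suc (length xs)               ≤⟨ s≤s (Unique-⊆⇒length≤ u xs⊆ys₁₂) ⟩
  suc (length (ys₁ ++ ys₂))     ≡⟨ cong suc (length-++ ys₁) ⟩
  suc (length ys₁ + length ys₂) ≡⟨ +-suc (length ys₁) (length ys₂) ⟨
  length ys₁ + suc (length ys₂) ≡⟨ length-++ ys₁ ⟨
  length (ys₁ ++ x ∷ ys₂)       ∎
  where
  open ≤-Reasoning
  xs⊆ys₁₂ : xs ⊆ ys₁ ++ ys₂
  xs⊆ys₁₂ {z} z∈xs with ∈-++⁻ ys₁ (xs⊆ys (there z∈xs))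
  ... | inj₁ z∈ys₁ = ∈-++⁺ˡ z∈ys₁
  ... | inj₂ (here refl) = ⊥-elim (Unique[x∷xs]⇒x∉xs ux z∈xs)
  ... | inj₂ (there z∈ys₂) = ∈-++⁺ʳ ys₁ z∈ys₂

module _ {V : Set} {E : Rel V 0ℓ} where

  private variable
    x y z t : V

  targets : Star E x y → List V
  vertices : Star E x y → List V
  targets ε = []
  targets (e ◅ w) = vertices w
  vertices {x} w = x ∷ targets w

  targets-◅◅ : (w : Star E x y) (w′ : Star E y z) → targets (w ◅◅ w′) ≡ targets w ++ targets w′
  targets-◅◅ ε w′ = refl
  targets-◅◅ (_◅_ {j = y} e w) w′ = cong (y ∷_) (targets-◅◅ w w′)

  vertices-◅◅ : (w : Star E x y) (w′ : Star E y z) → vertices (w ◅◅ w′) ≡ vertices w ++ targets w′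
  vertices-◅◅ {x} w w′ = cong (x ∷_) (targets-◅◅ w w′)

  ∈-◅◅⁻ : (w : Star E x y) (w′ : Star E y z) → t ∈ vertices (w ◅◅ w′) → t ∈ vertices w ⊎ t ∈ vertices w′
  ∈-◅◅⁻ {t = t} w w′ t∈ with ∈-++⁻ (vertices w) (subst (t ∈_) (vertices-◅◅ w w′) t∈)
  ... | inj₁ t∈w = inj₁ t∈w
  ... | inj₂ t∈w′ = inj₂ (there t∈w′)

  ∈-◅◅⁺ˡ : (w : Star E x y) (w′ : Star E y z) → t ∈ vertices w → t ∈ vertices (w ◅◅ w′)
  ∈-◅◅⁺ˡ {t = t} w w′ t∈ = subst (t ∈_) (sym (vertices-◅◅ w w′)) (∈-++⁺ˡ t∈)

  end∈ : (w : Star E x y) → y ∈ vertices w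
  end∈ ε = here refl
  end∈ (e ◅ w) = there (end∈ w)

  end∈targets : x ≢ y → (w : Star E x y) → y ∈ targets w
  end∈targets x≢y ε = ⊥-elim (x≢y refl)
  end∈targets x≢y (e ◅ w) = end∈ w

  linked : (w : Star E x y) → Linked E (vertices w)
  linked ε = [-]
  linked (e ◅ ε) = e ∷ [-]
  linked (e ◅ e′ ◅ w) = e ∷ linked (e′ ◅ w)

  takeTo : (w : Star E x z) → t ∈ vertices w → Star E x t
  takeTo w (here refl) = ε
  takeTo (e ◅ w) (there t∈) = e ◅ takeTo w t∈

  dropTo : (w : Star E x z) → t ∈ vertices w → Star E t z
  dropTo w (here refl) = w
  dropTo (e ◅ w) (there t∈) = dropTo w t∈

  takeTo-⊆ : (w : Star E x z) (t∈ : t ∈ vertices w) → vertices (takeTo w t∈) ⊆ vertices w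
  takeTo-⊆ w (here refl) (here refl) = here refl
  takeTo-⊆ (e ◅ w) (there t∈) (here refl) = here refl
  takeTo-⊆ (e ◅ w) (there t∈) (there s∈) = there (takeTo-⊆ w t∈ s∈)

  dropTo-⊆ : (w : Star E x z) (t∈ : t ∈ vertices w) → vertices (dropTo w t∈) ⊆ vertices w
  dropTo-⊆ w (here refl) = id
  dropTo-⊆ (e ◅ w) (there t∈) = there ∘ dropTo-⊆ w t∈

  takeTo-unique : (w : Star E x z) (t∈ : t ∈ vertices w) →
                  Unique (vertices w) → Unique (vertices (takeTo w t∈))
  takeTo-unique w (here refl) _ = [] ∷ []
  takeTo-unique (e ◅ w) (there t∈) (x∉ ∷ u) = anti-mono (takeTo-⊆ w t∈) x∉ ∷ takeTo-unique w t∈ u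

  dropTo-unique : (w : Star E x z) (t∈ : t ∈ vertices w) →
                  Unique (vertices w) → Unique (vertices (dropTo w t∈))
  dropTo-unique w (here refl) u = u
  dropTo-unique (e ◅ w) (there t∈) (_ ∷ u) = dropTo-unique w t∈ u

  end∉takeTo : (w : Star E x z) (t∈ : t ∈ vertices w) → Unique (vertices w) → t ≢ z →
               z ∉ vertices (takeTo w t∈)
  end∉takeTo w (here refl) _ t≢z (here refl) = t≢z refl
  end∉takeTo (e ◅ w) (there t∈) u t≢z (here refl) = Unique[x∷xs]⇒x∉xs u (end∈ w)
  end∉takeTo (e ◅ w) (there t∈) (_ ∷ u) t≢z (there z∈) = end∉takeTo w t∈ u t≢z z∈

  firstHit : {P : Pred V 0ℓ} → Decidable P → (w : Star E x z) → P z →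
             Σ V λ t → P t × Σ (Star E x t) λ w′ →
               vertices w′ ⊆ vertices w × (∀ {s} → s ∈ vertices w′ → P s → s ≡ t)
  firstHit {x = x} P? w Pz with P? x
  ... | yes Px = x , Px , ε , (λ { (here refl) → here refl }) , (λ { (here refl) _ → refl })
  firstHit P? ε Pz | no ¬Px = ⊥-elim (¬Px Pz)
  firstHit P? (e ◅ w) Pz | no ¬Px with firstHit P? w Pz
  ... | t , Pt , w′ , w′⊆w , first =
    t , Pt , e ◅ w′ , (λ { (here refl) → here refl ; (there s∈) → there (w′⊆w s∈) }) ,
    λ { (here refl) Ps → ⊥-elim (¬Px Ps) ; (there s∈) Ps → first s∈ Ps }

  unsnoc : (w : Star E x z) → x ≢ z →
           Σ V λ c → Σ (Star E x c) λ w′ → Σ (E c z) λ e → w′ ◅◅ (e ◅ ε) ≡ w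
  unsnoc ε x≢z = ⊥-elim (x≢z refl)
  unsnoc (e ◅ w) _ = unsnoc◅ e w
    where
    unsnoc◅ : (e : E x y) (w : Star E y z) →
              Σ V λ c → Σ (Star E x c) λ w′ → Σ (E c z) λ e′ → w′ ◅◅ (e′ ◅ ε) ≡ e ◅ w
    unsnoc◅ e ε = _ , ε , e , refl
    unsnoc◅ e (e₁ ◅ w) with unsnoc◅ e₁ w
    ... | c , w′ , e′ , eq = c , e ◅ w′ , e′ , cong (e ◅_) eq

  targets-nonempty : x ≢ y → (w : Star E x y) → 1 ≤ length (targets w)
  targets-nonempty x≢y ε = ⊥-elim (x≢y refl)
  targets-nonempty x≢y (e ◅ w) = s≤s z≤n

vertices-map : {V : Set} {E E′ : Rel V 0ℓ} {x y : V} (f : ∀ {a b} → E a b → E′ a b) (w : Star E x y) →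
               vertices (map {T = E} {U = E′} f w) ≡ vertices w
vertices-map f ε = refl
vertices-map {x = x} f (e ◅ w) = cong (x ∷_) (vertices-map f w)

module Paths {V : Set} (_≟_ : DecidableEquality V) (E : Rel V 0ℓ) (E-sym : Symmetric E) where

  open import Data.List.Membership.DecPropositional _≟_ using (_∈?_)
  open ≡-Reasoning

  private variable
    x y z t : V

  walk-reverse : Star E x y → Star E y x
  walk-reverse = reverse E-sym

  vertices-revApp : (w : Star E y x) (acc : Star E y z) →
                    vertices (revApp E-sym w acc) ≡ vertices w ʳ++ targets acc
  vertices-revApp ε acc = refl
  vertices-revApp (e ◅ w) acc = vertices-revApp w (E-sym e ◅ acc)

  ∈-reverse⁻ : (w : Star E x y) → t ∈ vertices (walk-reverse w) → t ∈ vertices w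
  ∈-reverse⁻ {t = t} w t∈ = Any-reverse⁻ (subst (t ∈_) (vertices-revApp w ε) t∈)

  toPath : (w : Star E x y) → Σ (Star E x y) λ w′ → Unique (vertices w′) × vertices w′ ⊆ vertices w
  toPath ε = ε , [] ∷ [] , id
  toPath {x} (e ◅ w) with toPath w
  ... | w′ , u′ , w′⊆w with x ∈? vertices w′
  ...   | no x∉ = e ◅ w′ , Unique-∷⁺ x∉ u′ , λ { (here refl) → here refl ; (there s∈) → there (w′⊆w s∈) }
  ...   | yes x∈ = dropTo w′ x∈ , dropTo-unique w′ x∈ u′ , there ∘ w′⊆w ∘ dropTo-⊆ w′ x∈

  CycleFrom : V → V → Set
  CycleFrom p r = Σ (List V) λ xs → 2 ≤ length xs × Unique (p ∷ xs)
                  × Linked E ((p ∷ xs) ∷ʳ p) × r ∈ p ∷ xs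

  WalkAvoiding : V → V → V → Set
  WalkAvoiding x p r = Σ (Star E p r) λ w → x ∉ vertices w

  Separates : V → V → V → Set
  Separates x p r = ¬ WalkAvoiding x p r

  module _ {p : V} where

    -- Invariant of the ear argument: it starts with the first edge of a p–r path taken twice
    -- and moves v along that path.
    record TwoPaths (v : V) : Set where
      field
        path₁ path₂ : Star E p v
        unique₁ : Unique (vertices path₁)
        unique₂ : Unique (vertices path₂)
        meet-at-ends : ∀ {z} → z ∈ vertices path₁ → z ∈ vertices path₂ → z ≡ p ⊎ z ≡ v

    open TwoPaths

    swap : ∀ {v} → TwoPaths v → TwoPaths v
    swap T = record { path₁ = path₂ T ; path₂ = path₁ T ; unique₁ = unique₂ T ; unique₂ = unique₁ T
                    ; meet-at-ends = λ z∈₁ z∈₂ → meet-at-ends T z∈₂ z∈₁ }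

    OnPaths : ∀ {v} → TwoPaths v → Pred V 0ℓ
    OnPaths T z = z ∈ vertices (path₁ T) ⊎ z ∈ vertices (path₂ T)

    onPaths? : ∀ {v} (T : TwoPaths v) → Decidable (OnPaths T)
    onPaths? T z = (z ∈? vertices (path₁ T)) ⊎-dec (z ∈? vertices (path₂ T))

    reroute : ∀ {v t y} (T : TwoPaths v) (t∈ : t ∈ vertices (path₁ T)) → t ≢ v →
              (S : Star E t y) → Unique (vertices S) → (∀ {z} → z ∈ vertices S → OnPaths T z → z ≡ t) →
              y ≢ p → y ≢ v → E v y → TwoPaths y
    reroute {v} {t} {y} T t∈ t≢v S uS S-first y≢p y≢v e = record
      { path₁ = X₁ ◅◅ S
      ; path₂ = Y ◅◅ (e ◅ ε)
      ; unique₁ = subst Unique (sym (vertices-◅◅ X₁ S))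
                    (Unique-++⁺ (takeTo-unique X t∈ (unique₁ T)) (tail uS) X₁-S-disjoint)
      ; unique₂ = subst Unique (sym (vertices-◅◅ Y (e ◅ ε)))
                    (Unique-++⁺ (unique₂ T) ([] ∷ []) λ { (y∈ , here refl) → y∉Y y∈ })
      ; meet-at-ends = meet
      }
      where
      X = path₁ T
      Y = path₂ T
      X₁ = takeTo X t∈

      v∉X₁ : v ∉ vertices X₁
      v∉X₁ = end∉takeTo X t∈ (unique₁ T) t≢v

      X₁-S-disjoint : Disjoint (vertices X₁) (targets S)
      X₁-S-disjoint (z∈X₁ , z∈S) with S-first (there z∈S) (inj₁ (takeTo-⊆ X t∈ z∈X₁))
      ... | refl = Unique[x∷xs]⇒x∉xs uS z∈S

      y∉Y : y ∉ vertices Y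
      y∉Y y∈ with S-first (end∈ S) (inj₂ y∈)
      ... | refl with meet-at-ends T t∈ y∈
      ...   | inj₁ y≡p = y≢p y≡p
      ...   | inj₂ y≡v = y≢v y≡v

      meet : ∀ {z} → z ∈ vertices (X₁ ◅◅ S) → z ∈ vertices (Y ◅◅ (e ◅ ε)) → z ≡ p ⊎ z ≡ y
      meet z∈₁ z∈₂ with ∈-◅◅⁻ X₁ S z∈₁ | ∈-◅◅⁻ Y (e ◅ ε) z∈₂
      ... | _ | inj₂ (there (here refl)) = inj₂ refl
      ... | inj₁ z∈X₁ | inj₂ (here refl) = ⊥-elim (v∉X₁ z∈X₁)
      ... | inj₂ z∈S | inj₂ (here refl) = ⊥-elim (t≢v (sym (S-first z∈S (inj₁ (end∈ X)))))
      ... | inj₁ z∈X₁ | inj₁ z∈Y with meet-at-ends T (takeTo-⊆ X t∈ z∈X₁) z∈Y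
      ...   | inj₁ z≡p = inj₁ z≡p
      ...   | inj₂ refl = ⊥-elim (v∉X₁ z∈X₁)
      meet z∈₁ z∈₂ | inj₂ z∈S | inj₁ z∈Y with S-first z∈S (inj₂ z∈Y)
      ... | refl with meet-at-ends T t∈ z∈Y
      ...   | inj₁ z≡p = inj₁ z≡p
      ...   | inj₂ z≡v = ⊥-elim (t≢v z≡v)

    extend : ∀ {v y} → TwoPaths v → E v y → y ≢ p → y ≢ v →
             (R : Star E y p) → v ∉ vertices R → TwoPaths y
    extend {v} {y} T e y≢p y≢v R v∉R with firstHit (onPaths? T) R (inj₁ (here refl))
    ... | t , t-on , R₁ , R₁⊆R , R₁-first = reroute-at t-on
      where
      t≢v : t ≢ v
      t≢v refl = v∉R (R₁⊆R (end∈ R₁))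

      back : Σ (Star E t y) λ S → Unique (vertices S) × (∀ {z} → z ∈ vertices S → OnPaths T z → z ≡ t)
      back with toPath (walk-reverse R₁)
      ... | S , uS , S⊆ = S , uS , λ z∈S → R₁-first (∈-reverse⁻ R₁ (S⊆ z∈S))

      reroute-at : OnPaths T t → TwoPaths y
      reroute-at (inj₁ t∈₁) = let (S , uS , S-first) = back in
        reroute T t∈₁ t≢v S uS S-first y≢p y≢v e
      reroute-at (inj₂ t∈₂) = let (S , uS , S-first) = back in
        reroute (swap T) t∈₂ t≢v S uS (λ z∈S → S-first z∈S ∘ ⊎-swap) y≢p y≢v e

    twoPaths⇒cycle : ∀ {r} → p ≢ r → ¬ E p r → TwoPaths r → CycleFrom p r
    twoPaths⇒cycle {r} p≢r ¬pr T with toPath (walk-reverse (path₂ T))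
    ... | C , uC , C⊆ with unsnoc C (p≢r ∘ sym)
    ... | c , C₀ , e , refl =
      targets A ++ targets C₀ , length-bound , cycle-unique , cycle-linked ,
      there (∈-++⁺ˡ (end∈targets p≢r A))
      where
      A = path₁ T
      C₀-facts : Unique (vertices C₀) × p ∉ vertices C₀
      C₀-facts = Unique-∷ʳ⁻ (vertices C₀) (subst Unique (vertices-◅◅ C₀ (e ◅ ε)) uC)

      r≢c : r ≢ c
      r≢c refl = ¬pr (E-sym e)

      length-bound : 2 ≤ length (targets A ++ targets C₀)
      length-bound rewrite length-++ (targets A) {targets C₀} =
        +-mono-≤ (targets-nonempty p≢r A) (targets-nonempty r≢c C₀)

      A-C₀-disjoint : Disjoint (vertices A) (targets C₀)
      A-C₀-disjoint (z∈A , z∈C₀)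
        with meet-at-ends T z∈A (∈-reverse⁻ (path₂ T) (C⊆ (∈-◅◅⁺ˡ C₀ _ (there z∈C₀))))
      ... | inj₁ refl = proj₂ C₀-facts (there z∈C₀)
      ... | inj₂ refl = Unique[x∷xs]⇒x∉xs (proj₁ C₀-facts) z∈C₀

      cycle-unique : Unique (p ∷ targets A ++ targets C₀)
      cycle-unique = Unique-++⁺ (unique₁ T) (tail (proj₁ C₀-facts)) A-C₀-disjoint

      cycle-linked : Linked E ((p ∷ targets A ++ targets C₀) ∷ʳ p)
      cycle-linked = subst (Linked E) vertices-cycle (linked (A ◅◅ C₀ ◅◅ (e ◅ ε)))
        where
        vertices-cycle : vertices (A ◅◅ C₀ ◅◅ (e ◅ ε)) ≡ (p ∷ targets A ++ targets C₀) ∷ʳ p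
        vertices-cycle = begin
          vertices (A ◅◅ C₀ ◅◅ (e ◅ ε))
            ≡⟨ vertices-◅◅ A (C₀ ◅◅ (e ◅ ε)) ⟩
          vertices A ++ targets (C₀ ◅◅ (e ◅ ε))
            ≡⟨ cong (vertices A ++_) (targets-◅◅ C₀ (e ◅ ε)) ⟩
          p ∷ targets A ++ targets C₀ ++ [ p ]
            ≡⟨ cong (p ∷_) (++-assoc (targets A) (targets C₀) [ p ]) ⟨
          (p ∷ targets A ++ targets C₀) ∷ʳ p
            ∎

    extendAlong : ∀ {v r} → (∀ x → x ≢ p → x ≢ r → ¬ Separates x p r) →
                  (S : Star E v r) → Unique (vertices S) → p ∉ vertices S → TwoPaths v → ¬ ¬ TwoPaths r
    extendAlong _ ε _ _ T k = k T
    extendAlong {v} {r} unseparated (_◅_ {j = y} e S) uS p∉S T k =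
      unseparated v v≢p v≢r λ (Q , v∉Q) →
        extendAlong unseparated S (tail uS) (p∉S ∘ there)
          (extend T e y≢p y≢v (S ◅◅ walk-reverse Q) (v∉R Q v∉Q)) k
      where
      v∉S : v ∉ vertices S
      v∉S = Unique[x∷xs]⇒x∉xs uS
      v≢p : v ≢ p
      v≢p refl = p∉S (here refl)
      v≢r : v ≢ r
      v≢r refl = v∉S (end∈ S)
      y≢p : y ≢ p
      y≢p refl = p∉S (there (here refl))
      y≢v : y ≢ v
      y≢v refl = v∉S (here refl)
      v∉R : (Q : Star E p r) → v ∉ vertices Q → v ∉ vertices (S ◅◅ walk-reverse Q)
      v∉R Q v∉Q v∈ with ∈-◅◅⁻ S (walk-reverse Q) v∈
      ... | inj₁ v∈S = v∉S v∈S
      ... | inj₂ v∈Q = v∉Q (∈-reverse⁻ Q v∈Q)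

    unseparated⇒cycle : ∀ {r} → p ≢ r → ¬ E p r → Star E p r →
                        (∀ x → x ≢ p → x ≢ r → ¬ Separates x p r) → ¬ ¬ CycleFrom p r
    unseparated⇒cycle p≢r ¬pr P unseparated with toPath P
    ... | ε , _ , _ = ⊥-elim (p≢r refl)
    ... | _◅_ {j = v} e S , uP , _ = λ k →
      extendAlong unseparated S (tail uP) p∉S single-edge (k ∘ twoPaths⇒cycle p≢r ¬pr)
      where
      p∉S : p ∉ vertices S
      p∉S = Unique[x∷xs]⇒x∉xs uP
      edge-unique : Unique (p ∷ v ∷ [])
      edge-unique = Unique-∷⁺ (λ { (here p≡v) → p∉S (here p≡v) }) ([] ∷ [])
      single-edge : TwoPaths v
      single-edge = record
        { path₁ = e ◅ ε ; path₂ = e ◅ ε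
        ; unique₁ = edge-unique ; unique₂ = edge-unique
        ; meet-at-ends = λ { (here refl) _ → inj₁ refl ; (there (here refl)) _ → inj₂ refl } }


walk-head : ∀ {V : Set} {In : V → Set} {R : V → V → Set} {s s′} → Walk In R s s′ → In s
walk-head (here Is) = Is
walk-head (step Is _ _) = Is

SamePair-symˡ : {V : Set} {x y u w : V} → SamePair x y u w → SamePair y x u w
SamePair-symˡ (inj₁ (x≡u , y≡w)) = inj₂ (y≡w , x≡u)
SamePair-symˡ (inj₂ (x≡w , y≡u)) = inj₁ (y≡u , x≡w)

SamePair-symʳ : {V : Set} {x y u w : V} → SamePair x y u w → SamePair x y w u
SamePair-symʳ (inj₁ eqs) = inj₂ eqs
SamePair-symʳ (inj₂ eqs) = inj₁ eqs

record TwoNeighbours {V : Set} (D : V → V → Set) (x y : V) : Set where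
  field
    t₁ t₂ : V
    t₁≢t₂ : t₁ ≢ t₂
    edge₁ : D x t₁
    edge₂ : D x t₂
    t₁≢y : t₁ ≢ y
    t₂≢y : t₂ ≢ y

TwoNeighbours-map : {V : Set} {D D′ : V → V → Set} {x y : V} →
                    (∀ {a b} → D a b → D′ a b) → TwoNeighbours D x y → TwoNeighbours D′ x y
TwoNeighbours-map f T = record { TwoNeighbours T ; edge₁ = f edge₁ ; edge₂ = f edge₂ }
  where open TwoNeighbours T

two-neighbours : {V : Set} {In : V → Set} {D : V → V → Set} → (∀ {a b} → D a b → a ≢ b) →
                 TwoConnected In D → ∀ {x y} → In x → In y → x ≢ y → ¬ D x y → TwoNeighbours D x y
two-neighbours D-irrefl (_ , connected , no-cut) {x} {y} Ix Iy x≢y ¬Dxy with connected x y Ix Iy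
... | here _ = ⊥-elim (x≢y refl)
... | step {y = t₁} _ Dxt₁ rest
  with no-cut t₁ (walk-head rest) x y (Ix , D-irrefl Dxt₁) (Iy , λ { refl → ¬Dxy Dxt₁ })
...   | here _ = ⊥-elim (x≢y refl)
...   | step {y = t₂} _ Dxt₂ rest₂ = record
  { t₁ = t₁ ; t₂ = t₂ ; t₁≢t₂ = λ t₁≡t₂ → proj₂ (walk-head rest₂) (sym t₁≡t₂)
  ; edge₁ = Dxt₁ ; edge₂ = Dxt₂ ; t₁≢y = λ { refl → ¬Dxy Dxt₁ } ; t₂≢y = λ { refl → ¬Dxy Dxt₂ } }

module _ (G : Graph) (Mt : Matching G) where
  open Graph G renaming (sym to Adj-sym)
  open Matching Mt
  open Equivalence using (to; from)

  Pair : Set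
  Pair = Fin n × Fin n

  infix 4 _∈ₚ_
  _∈ₚ_ : Fin n → Pair → Set
  _∈ₚ_ = InPair G Mt

  private variable
    x y z : Fin n
    s s′ : Pair

  adjacent⇒≢ : Adj x y ≡ true → x ≢ y
  adjacent⇒≢ {x} Axx refl with trans (sym Axx) (irrefl x)
  ... | ()

  matched⇒≢ : M x y ≡ true → x ≢ y
  matched⇒≢ = adjacent⇒≢ ∘ M⊆E _ _

  ∈ₚ-unique : VM G Mt s → VM G Mt s′ → z ∈ₚ s → z ∈ₚ s′ → s ≡ s′
  ∈ₚ-unique {a , b} {a′ , b′} (Mab , a<b) (Ma′b′ , a′<b′) = cases
    where
    cases : z ∈ₚ (a , b) → z ∈ₚ (a′ , b′) → (a , b) ≡ (a′ , b′)
    cases (inj₁ refl) (inj₁ refl) with M-match a b b′ Mab Ma′b′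
    ... | refl = refl
    cases (inj₁ refl) (inj₂ refl) with M-match a b a′ Mab (trans (M-sym a a′) Ma′b′)
    ... | refl = ⊥-elim (<-asym a<b a′<b′)
    cases (inj₂ refl) (inj₁ refl) with M-match b a b′ (trans (M-sym b a) Mab) Ma′b′
    ... | refl = ⊥-elim (<-asym a<b a′<b′)
    cases (inj₂ refl) (inj₂ refl) with M-match b a a′ (trans (M-sym b a) Mab) (trans (M-sym b a′) Ma′b′)
    ... | refl = refl

  Ord⇒partner∈ : Ord G Mt z y s → y ∈ₚ s
  Ord⇒partner∈ (inj₁ (_ , y≡b)) = inj₂ y≡b
  Ord⇒partner∈ (inj₂ (_ , y≡a)) = inj₁ y≡a

  Ord⇒members : ∀ {t} → Ord G Mt z y s → t ∈ₚ s → t ≡ z ⊎ t ≡ y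
  Ord⇒members (inj₁ (refl , refl)) (inj₁ eq) = inj₁ eq
  Ord⇒members (inj₁ (refl , refl)) (inj₂ eq) = inj₂ eq
  Ord⇒members (inj₂ (refl , refl)) (inj₁ eq) = inj₂ eq
  Ord⇒members (inj₂ (refl , refl)) (inj₂ eq) = inj₁ eq

  Red-sym : Red G Mt s′ s → Red G Mt s s′
  Red-sym (p , q , r , t , orders , rest) = p , q , r , t , ⊎-swap orders , rest

  record Partner (z : Fin n) (s : Pair) : Set where
    field
      partner : Fin n
      matched : M z partner ≡ true
      ordered : Ord G Mt z partner s

    partner∈ : partner ∈ₚ s
    partner∈ = Ord⇒partner∈ ordered

    members : ∀ {y} → y ∈ₚ s → y ≡ z ⊎ y ≡ partner
    members = Ord⇒members ordered

  partnerOf : VM G Mt s → z ∈ₚ s → Partner z s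
  partnerOf {a , b} (Mab , _) (inj₁ refl) =
    record { partner = b ; matched = Mab ; ordered = inj₁ (refl , refl) }
  partnerOf {a , b} (Mab , _) (inj₂ refl) =
    record { partner = a ; matched = trans (M-sym b a) Mab ; ordered = inj₂ (refl , refl) }

  matched⇒∈ₚ : M x y ≡ true → Σ Pair λ s → VM G Mt s × x ∈ₚ s
  matched⇒∈ₚ {x} {y} Mxy with <-cmp x y
  ... | tri< x<y _ _ = (x , y) , (Mxy , x<y) , inj₁ refl
  ... | tri≈ _ x≡y _ = ⊥-elim (matched⇒≢ Mxy x≡y)
  ... | tri> _ _ y<x = (y , x) , (trans (M-sym y x) Mxy , y<x) , inj₂ refl

  matched⇒covered : M x y ≡ true → covered G Mt x ≡ true
  matched⇒covered {x} {y} Mxy = to T-≡ (any⁺ (M x) (lose (∈-allFin y) (from T-≡ Mxy)))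

  covered⇒∈ₚ : covered G Mt x ≡ true → Σ Pair λ s → VM G Mt s × x ∈ₚ s
  covered⇒∈ₚ {x} cov = matched⇒∈ₚ (to T-≡ (proj₂ (satisfied (any⁻ (M x) (allFin n) (from T-≡ cov)))))

  ∈ₚ⇒covered : VM G Mt s → z ∈ₚ s → covered G Mt z ≡ true
  ∈ₚ⇒covered Vs z∈s = matched⇒covered (Partner.matched (partnerOf Vs z∈s))

  isNeighbour : Fin n → Fin n → Bool
  isNeighbour x y = Adj x y ∧ covered G Mt y

  Neighbour : Fin n → Fin n → Set
  Neighbour x y = T (isNeighbour x y)

  neighbour : Adj x y ≡ true → covered G Mt y ≡ true → Neighbour x y
  neighbour Axy cov = from T-∧ (from T-≡ Axy , from T-≡ cov)

  neighbour⁻ : Neighbour x y → Adj x y ≡ true × covered G Mt y ≡ true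
  neighbour⁻ nb with to T-∧ nb
  ... | Axy , cov = to T-≡ Axy , to T-≡ cov

  length≤degM : ∀ {ys} → Unique ys → (∀ {y} → y ∈ ys → Neighbour x y) → length ys ≤ degM G Mt x
  length≤degM {x} u ys-nb =
    Unique-⊆⇒length≤ u λ y∈ → ∈-filter⁺ (T? ∘ isNeighbour x) (∈-allFin _) (ys-nb y∈)

  degM≤length : ∀ {ys} → (∀ {y} → Neighbour x y → y ∈ ys) → degM G Mt x ≤ length ys
  degM≤length {x} nb-ys =
    Unique-⊆⇒length≤ (filter⁺ (T? ∘ isNeighbour x) (allFin⁺ n))
      (nb-ys ∘ proj₂ ∘ ∈-filter⁻ (T? ∘ isNeighbour x) {xs = allFin n})

  module Lift {U W : Pair} (VU : VM G Mt U) (VW : VM G Mt W) (U≢W : U ≢ W)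
              {p r : Fin n} (p∈U : p ∈ₚ U) (r∈W : r ∈ₚ W) where

    E : Fin n → Fin n → Set
    E = AdjMinus G Mt p r

    E-sym : Symmetric E
    E-sym {x} {y} (Axy , ¬pr) = trans (Adj-sym y x) Axy , ¬pr ∘ SamePair-symˡ

    open Paths _≟ᶠ_ E E-sym public

    p≢r : p ≢ r
    p≢r refl = U≢W (∈ₚ-unique VU VW p∈U r∈W)

    matching-edge : VM G Mt s → x ∈ₚ s → y ∈ₚ s → x ≢ y → E x y
    matching-edge {x = x} {y = y} Vs x∈s y∈s x≢y = Adj-in-pair , λ
      { (inj₁ (refl , refl)) → U≢W (trans (∈ₚ-unique VU Vs p∈U x∈s) (∈ₚ-unique Vs VW y∈s r∈W))
      ; (inj₂ (refl , refl)) → U≢W (trans (∈ₚ-unique VU Vs p∈U y∈s) (∈ₚ-unique Vs VW x∈s r∈W)) }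
      where
      open Partner (partnerOf Vs x∈s)
      Adj-in-pair : Adj x y ≡ true
      Adj-in-pair with members y∈s
      ... | inj₁ y≡x = ⊥-elim (x≢y (sym y≡x))
      ... | inj₂ refl = M⊆E x y matched

    cross-edge : VM G Mt s → VM G Mt s′ → ¬ SamePair s s′ U W → x ∈ₚ s → y ∈ₚ s′ →
                 Adj x y ≡ true → E x y
    cross-edge Vs Vs′ ¬UW x∈s y∈s′ Axy = Axy , λ
      { (inj₁ (refl , refl)) → ¬UW (inj₁ (∈ₚ-unique Vs VU x∈s p∈U , ∈ₚ-unique Vs′ VW y∈s′ r∈W))
      ; (inj₂ (refl , refl)) → ¬UW (inj₂ (∈ₚ-unique Vs VW x∈s r∈W , ∈ₚ-unique Vs′ VU y∈s′ p∈U)) }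

    LiesIn : (Pair → Set) → Fin n → Set
    LiesIn In z = Σ Pair λ s → In s × VM G Mt s × z ∈ₚ s

    LiftedWalk : (Pair → Set) → Fin n → Fin n → Set
    LiftedWalk In x y = Σ (Star E x y) λ w → ∀ {z} → z ∈ vertices w → LiesIn In z

    within : ∀ {In} → In s → VM G Mt s → x ∈ₚ s → y ∈ₚ s →
             LiftedWalk In x y
    within {s} {x} {y} Is Vs x∈s y∈s with x ≟ᶠ y
    ... | yes refl = ε , λ { (here refl) → s , Is , Vs , x∈s }
    ... | no x≢y = matching-edge Vs x∈s y∈s x≢y ◅ ε ,
                   λ { (here refl) → s , Is , Vs , x∈s ; (there (here refl)) → s , Is , Vs , y∈s }

    lift : ∀ {In : Pair → Set} {R : Pair → Pair → Set} →
           (∀ {s s′} → In s → In s′ → R s s′ → EM G Mt s s′ × ¬ SamePair s s′ U W) →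
           Walk In R s s′ → VM G Mt s → x ∈ₚ s → y ∈ₚ s′ →
           LiftedWalk In x y
    lift R-ok (here Is) Vs x∈s y∈s = within Is Vs x∈s y∈s
    lift {In = In} R-ok (step Is Rss₁ rest) Vs x∈s y∈s′
      with R-ok Is (walk-head rest) Rss₁
    ... | (_ , Vs₁ , _ , γ , δ , γ∈s , δ∈s₁ , Aγδ) , ¬UW
      with within Is Vs x∈s γ∈s | lift R-ok rest Vs₁ δ∈s₁ y∈s′
    ...   | w₁ , w₁-in | w₂ , w₂-in = w₁ ◅◅ e ◅ w₂ , lies-in
      where
      e : E γ δ
      e = cross-edge Vs Vs₁ ¬UW γ∈s δ∈s₁ Aγδ
      lies-in : ∀ {z} → z ∈ vertices (w₁ ◅◅ e ◅ w₂) → LiesIn In z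
      lies-in z∈ with ∈-◅◅⁻ w₁ (e ◅ w₂) z∈
      ... | inj₁ z∈w₁ = w₁-in z∈w₁
      ... | inj₂ (here refl) = w₁-in (end∈ w₁)
      ... | inj₂ (there z∈w₂) = w₂-in z∈w₂

    lifted-avoids : ∀ {In} → LiftedWalk In x y → (∀ {s} → In s → VM G Mt s → ¬ z ∈ₚ s) →
                    WalkAvoiding z x y
    lifted-avoids (w , lies) outside =
      w , λ z∈w → let (_ , Is , Vs , z∈s) = lies z∈w in outside Is Vs z∈s

    open Partner (partnerOf VU p∈U) public
      using () renaming ( partner to q ; matched to Mpq ; partner∈ to q∈U ; members to U-members
                        ; ordered to p-q-ordered )

    q≢r : q ≢ r
    q≢r refl = U≢W (∈ₚ-unique VU VW q∈U r∈W)

    ¬E-p-r : ¬ E p r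
    ¬E-p-r (_ , ¬pr) = ¬pr (inj₁ (refl , refl))

    p-r-unmatched : M p r ≡ false
    p-r-unmatched with M p r in Mpr
    ... | false = refl
    ... | true = ⊥-elim (q≢r (M-match p q r Mpq Mpr))

    p-q-neighbour : Neighbour p q
    p-q-neighbour = neighbour (M⊆E p q Mpq) (matched⇒covered (trans (M-sym q p) Mpq))

    q-p-neighbour : Neighbour q p
    q-p-neighbour = neighbour (M⊆E q p (trans (M-sym q p) Mpq)) (matched⇒covered Mpq)

    lift-avoiding-U : ∀ {t} → Connected (VM G Mt -ᵛ U) (EM G Mt) → VM G Mt t → t ≢ U → z ∈ₚ t →
                      WalkAvoiding q z r
    lift-avoiding-U connected Vt t≢U z∈t =
      lifted-avoids (lift R-ok (connected _ W (Vt , t≢U) (VW , U≢W ∘ sym)) Vt z∈t r∈W)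
        λ (_ , s≢U) Vs q∈s → s≢U (∈ₚ-unique Vs VU q∈s q∈U)
      where
      R-ok : ∀ {s s′} → (VM G Mt -ᵛ U) s → (VM G Mt -ᵛ U) s′ → EM G Mt s s′ →
             EM G Mt s s′ × ¬ SamePair s s′ U W
      R-ok (_ , s≢U) (_ , s′≢U) Ess′ =
        Ess′ , λ { (inj₁ (s≡U , _)) → s≢U s≡U ; (inj₂ (_ , s′≡U)) → s′≢U s′≡U }

    neighbour-pair≢U : ∀ {t} → Adj p z ≡ true → z ≢ q → z ∈ₚ t → t ≢ U
    neighbour-pair≢U Apz z≢q z∈t refl with U-members z∈t
    ... | inj₁ refl = adjacent⇒≢ Apz refl
    ... | inj₂ z≡q = z≢q z≡q

    avoid-partner-via : Connected (VM G Mt -ᵛ U) (EM G Mt) → Neighbour p z → z ≢ q → z ≢ r →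
                        WalkAvoiding q p r
    avoid-partner-via {z} connected nb z≢q z≢r with neighbour⁻ nb
    ... | Apz , cov-z with covered⇒∈ₚ cov-z
    ...   | t , Vt , z∈t with lift-avoiding-U connected Vt (neighbour-pair≢U Apz z≢q z∈t) z∈t
    ...     | w , q∉w = (Apz , pz≢pr) ◅ w , q∉
      where
      pz≢pr : ¬ SamePair p z p r
      pz≢pr (inj₁ (_ , z≡r)) = z≢r z≡r
      pz≢pr (inj₂ (p≡r , _)) = p≢r p≡r
      q∉ : q ∉ p ∷ vertices w
      q∉ (here q≡p) = matched⇒≢ Mpq (sym q≡p)
      q∉ (there q∈w) = q∉w q∈w

    module _ (only-q-r : ∀ {z} → Neighbour p z → z ≡ q ⊎ z ≡ r) where

      partner-adjacent : ∀ {t} → EM G Mt U t → t ≢ W → Σ (Fin n) λ β → β ∈ₚ t × Adj q β ≡ true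
      partner-adjacent (_ , Vt , U≢t , α , β , α∈U , β∈t , Aαβ) t≢W with U-members α∈U
      ... | inj₂ refl = β , β∈t , Aαβ
      ... | inj₁ refl with only-q-r (neighbour Aαβ (∈ₚ⇒covered Vt β∈t))
      ...   | inj₁ refl = ⊥-elim (U≢t (∈ₚ-unique VU Vt q∈U β∈t))
      ...   | inj₂ refl = ⊥-elim (t≢W (∈ₚ-unique Vt VW β∈t r∈W))

      degM-p≡2 : Adj p r ≡ true → degM G Mt p ≡ 2
      degM-p≡2 Apr =
        ≤-antisym (degM≤length {ys = q ∷ r ∷ []} q-or-r) (length≤degM unique-qr neighbours-qr)
        where
        q-or-r : ∀ {z} → Neighbour p z → z ∈ q ∷ r ∷ []
        q-or-r nb with only-q-r nb
        ... | inj₁ refl = here refl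
        ... | inj₂ refl = there (here refl)
        unique-qr : Unique (q ∷ r ∷ [])
        unique-qr = (q≢r ∷ []) ∷ [] ∷ []
        neighbours-qr : ∀ {z} → z ∈ q ∷ r ∷ [] → Neighbour p z
        neighbours-qr (here refl) = p-q-neighbour
        neighbours-qr (there (here refl)) = neighbour Apr (∈ₚ⇒covered VW r∈W)

      module _ (U-neighbours : TwoNeighbours (EM G Mt) U W) where
        open TwoNeighbours U-neighbours

        2<degM-q : 2 < degM G Mt q
        2<degM-q with partner-adjacent edge₁ t₁≢y | partner-adjacent edge₂ t₂≢y
        ... | β₁ , β₁∈t₁ , Aqβ₁ | β₂ , β₂∈t₂ , Aqβ₂ = length≤degM unique-pββ neighbours-pββ
          where
          Vt₁ : VM G Mt t₁
          Vt₁ = proj₁ (proj₂ edge₁)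
          Vt₂ : VM G Mt t₂
          Vt₂ = proj₁ (proj₂ edge₂)
          p∉ : ∀ {t β} → EM G Mt U t → β ∈ₚ t → p ≢ β
          p∉ (_ , Vt , U≢t , _) β∈t refl = U≢t (∈ₚ-unique VU Vt p∈U β∈t)
          unique-pββ : Unique (p ∷ β₁ ∷ β₂ ∷ [])
          unique-pββ = (p∉ edge₁ β₁∈t₁ ∷ p∉ edge₂ β₂∈t₂ ∷ [])
                     ∷ ((λ { refl → t₁≢t₂ (∈ₚ-unique Vt₁ Vt₂ β₁∈t₁ β₂∈t₂) }) ∷ [])
                     ∷ [] ∷ []
          neighbours-pββ : ∀ {z} → z ∈ p ∷ β₁ ∷ β₂ ∷ [] → Neighbour q z
          neighbours-pββ (here refl) = q-p-neighbour
          neighbours-pββ (there (here refl)) = neighbour Aqβ₁ (∈ₚ⇒covered Vt₁ β₁∈t₁)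
          neighbours-pββ (there (there (here refl))) = neighbour Aqβ₂ (∈ₚ⇒covered Vt₂ β₂∈t₂)

    overloaded-partner⇒red : Adj p r ≡ true → degM G Mt p ≡ 2 → 2 < degM G Mt q → Red G Mt U W
    overloaded-partner⇒red Apr deg-p deg-q =
      p , q , r , partner , inj₁ (p-q-ordered , ordered) , Apr , deg-p , deg-q
      where open Partner (partnerOf VW r∈W)

    avoid-partner : Adj p r ≡ true → Connected (VM G Mt -ᵛ U) (EM G Mt) → TwoNeighbours (EM G Mt) U W →
                    ¬ Red G Mt U W → WalkAvoiding q p r
    avoid-partner Apr connected U-neighbours not-red
      with any? (λ z → T? (isNeighbour p z) ×-dec ¬? (z ≟ᶠ q) ×-dec ¬? (z ≟ᶠ r))
    ... | yes (z , nb , z≢q , z≢r) = avoid-partner-via connected nb z≢q z≢r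
    ... | no ∄z =
      ⊥-elim (not-red (overloaded-partner⇒red Apr (degM-p≡2 only-q-r Apr)
                                                 (2<degM-q only-q-r U-neighbours)))
      where
      only-q-r : ∀ {z} → Neighbour p z → z ≡ q ⊎ z ≡ r
      only-q-r {z} nb with z ≟ᶠ q | z ≟ᶠ r
      ... | yes z≡q | _ = inj₁ z≡q
      ... | no _ | yes z≡r = inj₂ z≡r
      ... | no z≢q | no z≢r = ⊥-elim (∄z (z , nb , z≢q , z≢r))

  module BlueEdge {U W : Pair} (VU : VM G Mt U) (VW : VM G Mt W) (U≢W : U ≢ W)
                  {p r : Fin n} (p∈U : p ∈ₚ U) (r∈W : r ∈ₚ W) (Apr : Adj p r ≡ true)
                  (not-red : ¬ Red G Mt U W) (G_M-2conn : TwoConnected (VM G Mt) (EM G Mt))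
                  {HV : Pair → Set} {HE : Pair → Pair → Set} (H⊆G_M : IsSubgraphM G Mt HV HE)
                  (HEUW : HE U W) (H−e : TwoConnected HV (HE -ᵉ (U , W))) where

    open Lift VU VW U≢W p∈U r∈W public
    private
      -- Roles of (U, p) and (W, r) exchanged; Flipped.q is the partner s of r.
      module Flipped = Lift VW VU (U≢W ∘ sym) r∈W p∈U

      G_M-no-cut : ∀ X → VM G Mt X → Connected (VM G Mt -ᵛ X) (EM G Mt)
      G_M-no-cut = proj₂ (proj₂ G_M-2conn)

      H−e-connected : Connected HV (HE -ᵉ (U , W))
      H−e-connected = proj₁ (proj₂ H−e)

      H−e-no-cut : ∀ t → HV t → Connected (HV -ᵛ t) (HE -ᵉ (U , W))
      H−e-no-cut = proj₂ (proj₂ H−e)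

      HE⇒EM : ∀ {a b} → (HE -ᵉ (U , W)) a b → EM G Mt a b
      HE⇒EM (HEab , _) = proj₁ (proj₁ (proj₂ H⊆G_M) _ _ HEab)

      HVU : HV U
      HVU = proj₁ (proj₂ (proj₁ (proj₂ H⊆G_M) U W HEUW))

      HVW : HV W
      HVW = proj₂ (proj₂ (proj₁ (proj₂ H⊆G_M) U W HEUW))

      ¬UW : ∀ {X Y} → SamePair X Y U W → ¬ (HE -ᵉ (U , W)) X Y
      ¬UW same (_ , different) = different same

      neighbours-besides : ∀ {X Y} → HV X → HV Y → X ≢ Y → SamePair X Y U W → TwoNeighbours (EM G Mt) X Y
      neighbours-besides HVX HVY X≢Y same = TwoNeighbours-map HE⇒EM
        (two-neighbours (λ Eab → proj₁ (proj₂ (proj₂ (HE⇒EM Eab)))) H−e HVX HVY X≢Y (¬UW same))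

      flip-walk : ∀ {x} → Flipped.WalkAvoiding x r p → WalkAvoiding x p r
      flip-walk {x} (w , x∉w) =
        walk-reverse w′ , x∉w ∘ subst (x ∈_) (vertices-map flip-edge w) ∘ ∈-reverse⁻ w′
        where
        flip-edge : ∀ {a b} → Flipped.E a b → E a b
        flip-edge (Aab , ¬rp) = Aab , ¬rp ∘ SamePair-symʳ
        w′ = map flip-edge w

    lift-H−e : ∀ {In} → Walk In (HE -ᵉ (U , W)) U W → LiftedWalk In p r
    lift-H−e walk = lift (λ _ _ HEab → HE⇒EM HEab , proj₂ HEab) walk VU p∈U r∈W

    avoiding : ∀ {In x} → Walk In (HE -ᵉ (U , W)) U W → (∀ {s} → In s → VM G Mt s → ¬ x ∈ₚ s) →
               WalkAvoiding x p r
    avoiding walk = lifted-avoids (lift-H−e walk)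

    p⇝r : Star E p r
    p⇝r = proj₁ (lift-H−e (H−e-connected U W HVU HVW))

    avoid-other : ∀ {x} → ¬ x ∈ₚ U → ¬ x ∈ₚ W → ¬ Separates x p r
    avoid-other {x} x∉U x∉W separates with covered G Mt x in cov
    ... | false = separates (avoiding (H−e-connected U W HVU HVW) uncovered)
      where
      uncovered : ∀ {s} → HV s → VM G Mt s → ¬ x ∈ₚ s
      uncovered _ Vs x∈s with trans (sym (∈ₚ⇒covered Vs x∈s)) cov
      ... | ()
    ... | true with covered⇒∈ₚ cov
    -- Whether the pair t of x lies in H is undecidable: this is why the argument is double negated.
    ...   | t , Vt , x∈t = ¬¬-excluded-middle λ
      { (yes HVt) → separates (avoiding (H−e-no-cut t HVt U W (HVU , U≢t) (HVW , W≢t))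
                                 λ (_ , s≢t) Vs x∈s → s≢t (∈ₚ-unique Vs Vt x∈s x∈t))
      ; (no ¬HVt) → separates (avoiding (H−e-connected U W HVU HVW)
                                 λ HVs Vs x∈s → ¬HVt (subst HV (∈ₚ-unique Vs Vt x∈s x∈t) HVs)) }
      where
      U≢t : U ≢ t
      U≢t refl = x∉U x∈t
      W≢t : W ≢ t
      W≢t refl = x∉W x∈t

    unseparated : ∀ x → x ≢ p → x ≢ r → ¬ Separates x p r
    unseparated x x≢p x≢r with x ≟ᶠ q | x ≟ᶠ Flipped.q
    ... | yes refl | _ = λ separates → separates
      (avoid-partner Apr (G_M-no-cut U VU) (neighbours-besides HVU HVW U≢W (inj₁ (refl , refl))) not-red)
    ... | no _ | yes refl = λ separates → separates (flip-walk
      (Flipped.avoid-partner (trans (Adj-sym r p) Apr) (G_M-no-cut W VW)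
        (neighbours-besides HVW HVU (U≢W ∘ sym) (inj₂ (refl , refl))) (not-red ∘ Red-sym)))
    ... | no x≢q | no x≢s = avoid-other
      (λ x∈U → [ x≢p , x≢q ]′ (U-members x∈U)) (λ x∈W → [ x≢r , x≢s ]′ (Flipped.U-members x∈W))

corollary2 : (G : Graph) (Mt : Matching G) → PropertyP G Mt
  → (HV : Fin (Graph.n G) × Fin (Graph.n G) → Set)
  → (HE : Fin (Graph.n G) × Fin (Graph.n G) → Fin (Graph.n G) × Fin (Graph.n G) → Set)
  → IsSubgraphM G Mt HV HE
  → (u w : Fin (Graph.n G) × Fin (Graph.n G))
  → Blue G Mt u w → HE u w
  → TwoConnected HV HE
  → ¬ TwoConnected HV (HE -ᵉ (u , w))
corollary2 G Mt (G_M-2conn , no-cycle) HV HE H⊆G_M u w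
           ((Vu , Vw , u≢w , p , r , p∈u , r∈w , Apr) , not-red) HEuw _ H−e =
  unseparated⇒cycle p≢r ¬E-p-r p⇝r unseparated λ (xs , length-bound , unique , linked , r∈) →
    no-cycle p r Apr p-r-unmatched (∈ₚ⇒covered G Mt Vu p∈u) (∈ₚ⇒covered G Mt Vw r∈w)
      (p , xs , length-bound , unique , linked , here refl , r∈)
  where
  open BlueEdge G Mt Vu Vw u≢w p∈u r∈w Apr not-red G_M-2conn H⊆G_M HEuw H−e
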